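{- Let $\alpha$ be a node of $T$ and $(d,k)\in R_\alpha$. Then for every $d':X_\alpha\to\mathbb{N}$ with $d(v)\ge d'(v)$ for all $v\in X_\alpha$ and every integer $k'$ with $k\le k'\le|Y_\alpha|$, we have $(d',k')\in R_\alpha$.
   Context: $G=(V,E)$ is a simple undirected graph and $c:V\to\mathbb{N}$ a capacity function; $(T,\mathcal{X})$ is a (nice) tree decomposition of $G$ with bags $X_\alpha$. For a node $\alpha$, $V_\alpha$ is the union of the bags in the subtree rooted at $\alpha$, $Y_\alpha=V_\alpha\setminus X_\alpha$, and $G_\alpha$ is the graph with vertex set $V_\alpha$ and edge set $E[V_\alpha]\setminus E[X_\alpha]$. $R_\alpha$ is the set of pairs $(d,k)$ with $d:X_\alpha\to\mathbb{N}$, $k\in\mathbb{N}$, for which there is an orientation $O$ of $G_\alpha$ with: (1) $d(v)$ equals the out-degree of $v$ in $O$ for all $v\in X_\alpha$; (2) the in-degree of $v$ in $O$ is at most $c(v)$ for all $v\in Y_\alpha$; (3) the number of $v\in Y_\alpha$ with positive in-degree in $O$ is at most $k$, and $k\le|Y_\alpha|$. -}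

module Defs where

open import Data.Nat using (ℕ; zero; suc; _≤_; _<ᵇ_)
open import Data.Bool using (Bool; true; false)
open import Data.Fin using (Fin)
open import Data.Vec using (tabulate)
open import Data.List using (List; []; _∷_; _++_)
open import Data.List.Membership.Propositional as L using ()
open import Data.Fin.Subset as S
  using (Subset; _∈_; _∉_; _⊆_; _∪_; _∩_; _─_; _-_; ⁅_⁆; ∣_∣)
open import Data.Product using (Σ; ∃; _×_; _,_)
open import Data.Sum using (_⊎_)
import Data.Empty as Empty
open import Relation.Nullary using (¬_)
open import Relation.Binary.PropositionalEquality using (_≡_)

record Graph (n : ℕ) : Set where
  field
    adj    : Fin n → Fin n → Bool
    sym    : ∀ u v → adj u v ≡ adj v u
    irrefl : ∀ v → adj v v ≡ false

open Graph public

-- Rooted trees whose nodes carry bags (subsets of the vertex set).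
-- A node of T is identified with the subtree rooted at it.

data Tree (n : ℕ) : Set where
  node : Subset n → List (Tree n) → Tree n

bag : ∀ {n} → Tree n → Subset n
bag (node B _) = B

children : ∀ {n} → Tree n → List (Tree n)
children (node _ cs) = cs

mutual
  vertsT : ∀ {n} → Tree n → Subset n
  vertsT (node B cs) = B ∪ vertsF cs

  vertsF : ∀ {n} → List (Tree n) → Subset n
  vertsF []       = S.⊥
  vertsF (c ∷ cs) = vertsT c ∪ vertsF cs

Yset : ∀ {n} → Tree n → Subset n
Yset α = vertsT α ─ bag α

data _⊑_ {n : ℕ} : Tree n → Tree n → Set where
  here  : ∀ {t} → t ⊑ t
  child : ∀ {t c B cs} → t ⊑ c → c L.∈ cs → t ⊑ node B cs

-- Connectivity condition, in its local (rooted) form: for every node t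
-- with bag B and every child c, V_c ∩ B ⊆ X_c, and for any two children
-- at different positions, V_c ∩ V_d ⊆ B.  Together with the same
-- conditions at all descendants this is equivalent to: for each vertex v
-- the nodes whose bags contain v induce a connected subtree.
data Coherent {n : ℕ} : Tree n → Set where
  coh : ∀ {B cs} →
    (∀ c → c L.∈ cs → Coherent c) →
    (∀ c → c L.∈ cs → ∀ v → v ∈ vertsT c → v ∈ B → v ∈ bag c) →
    (∀ pre c post → cs ≡ pre ++ (c ∷ post) →
       ∀ d → d L.∈ (pre ++ post) →
       ∀ v → v ∈ vertsT c → v ∈ vertsT d → v ∈ B) →
    Coherent (node B cs)

record IsTreeDecomposition {n : ℕ} (G : Graph n) (T : Tree n) : Set where
  field
    vertexCover : ∀ v → Σ (Tree n) λ α → α ⊑ T × v ∈ bag α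
    edgeCover   : ∀ u v → adj G u v ≡ true →
                  Σ (Tree n) λ α → α ⊑ T × u ∈ bag α × v ∈ bag α
    coherent    : Coherent T

data IsNice {n : ℕ} : Tree n → Set where
  leaf      : IsNice (node S.⊥ [])
  introduce : ∀ {B c} v → v ∉ bag c → B ≡ bag c ∪ ⁅ v ⁆ →
              IsNice c → IsNice (node B (c ∷ []))
  forget    : ∀ {B c} v → v ∈ bag c → B ≡ bag c - v →
              IsNice c → IsNice (node B (c ∷ []))
  join      : ∀ {B c₁ c₂} → bag c₁ ≡ B → bag c₂ ≡ B →
              IsNice c₁ → IsNice c₂ → IsNice (node B (c₁ ∷ c₂ ∷ []))

EdgeAt : ∀ {n} → Graph n → Tree n → Fin n → Fin n → Set
EdgeAt G α u v =
  adj G u v ≡ true × u ∈ vertsT α × v ∈ vertsT α × ¬ (u ∈ bag α × v ∈ bag α)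

-- An orientation O of G_α: O u v ≡ true means the edge uv is oriented u → v.
record IsOrientation {n : ℕ} (G : Graph n) (α : Tree n)
                     (O : Fin n → Fin n → Bool) : Set where
  field
    onEdges : ∀ u v → O u v ≡ true → EdgeAt G α u v
    total   : ∀ u v → EdgeAt G α u v → O u v ≡ true ⊎ O v u ≡ true
    antisym : ∀ u v → O u v ≡ true → O v u ≡ true → Empty.⊥

outdeg : ∀ {n} → (Fin n → Fin n → Bool) → Fin n → ℕ
outdeg O v = ∣ tabulate (λ w → O v w) ∣

indeg : ∀ {n} → (Fin n → Fin n → Bool) → Fin n → ℕ
indeg O v = ∣ tabulate (λ w → O w v) ∣

positiveIn : ∀ {n} → (Fin n → Fin n → Bool) → Subset n
positiveIn O = tabulate (λ v → 0 <ᵇ indeg O v)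

-- (d , k) ∈ R_α.  The function d : X_α → ℕ is represented by a total
-- function Fin n → ℕ whose values outside X_α are irrelevant.
InR : ∀ {n} → Graph n → (Fin n → ℕ) → Tree n → (Fin n → ℕ) → ℕ → Set
InR {n'} G c α d k =
  Σ (Fin n' → Fin n' → Bool) λ O →
    IsOrientation G α O ×
    (∀ v → v ∈ bag α → d v ≡ outdeg O v) ×
    (∀ v → v ∈ Yset α → indeg O v ≤ c v) ×
    ∣ Yset α ∩ positiveIn O ∣ ≤ k ×
    k ≤ ∣ Yset α ∣

-- Reversing an arc x → w of G_α whose tail x lies in the bag lowers the
-- out-degree of x by one and leaves all other out-degrees of bag vertices
-- unchanged.  Since G_α has no edges inside the bag, w lies in Y_α, and the
-- reversal only removes an in-arc at w: capacities stay respected and no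
-- vertex of Y_α acquires positive in-degree.  Iterating such reversals
-- lowers every out-degree to the prescribed d′, and k may be raised freely
-- up to |Y_α|.
module Submission where

open import Defs hiding (sym)
open import Data.Bool using (Bool; true; false)
open import Data.Fin using (Fin; zero; suc; _≟_)
import Data.Fin.Properties as Fin
open import Data.Fin.Subset
  using (Subset; Nonempty; _∈_; _∉_; _∩_; _─_; ∣_∣; inside; outside)
open import Data.Fin.Subset.Properties
  using (p⊆q⇒∣p∣≤∣q∣; x∈p∩q⁺; x∈p∩q⁻; nonempty?; Empty-unique; ∣⊥∣≡0; _∈?_)
open import Data.List using (List; []; _∷_; allFin)
import Data.List.Membership.Propositional as List
open import Data.List.Membership.Propositional.Properties using (∈-allFin)
import Data.List.Relation.Unary.Any as Any
open import Data.Nat using (ℕ; zero; suc; _≤_; _<_; _<ᵇ_; s≤s; z≤n; _≤′_; ≤′-refl; ≤′-step)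
open import Data.Nat.Properties using (≤-trans; ≤-reflexive; <⇒≢; ≤⇒≤′; suc-injective)
open import Data.Empty using (⊥)
open import Data.Product using (∃; _×_; _,_; proj₁; proj₂; swap)
open import Data.Sum using (_⊎_; inj₁; inj₂)
open import Data.Vec using (_∷_; tabulate; here; there)
open import Data.Vec.Properties using (lookup⇒[]=; []=⇒lookup; lookup∘tabulate; tabulate-cong)
open import Function using (_∘_)
open import Relation.Nullary using (¬_; yes; no; contradiction)
open import Relation.Nullary.Decidable using (_×-dec_)
open import Relation.Binary.PropositionalEquality
  using (_≡_; _≢_; refl; sym; trans; cong; subst)

Arcs : ℕ → Set
Arcs n = Fin n → Fin n → Bool

∈-tabulate⁺ : ∀ {n} (f : Fin n → Bool) {x} → f x ≡ true → x ∈ tabulate f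
∈-tabulate⁺ f {x} fx = lookup⇒[]= x (tabulate f) (trans (lookup∘tabulate f x) fx)

∈-tabulate⁻ : ∀ {n} (f : Fin n → Bool) {x} → x ∈ tabulate f → f x ≡ true
∈-tabulate⁻ f {x} x∈f = trans (sym (lookup∘tabulate f x)) ([]=⇒lookup x∈f)

∣tabulate∣-mono : ∀ {n} {f g : Fin n → Bool} →
  (∀ i → f i ≡ true → g i ≡ true) → ∣ tabulate f ∣ ≤ ∣ tabulate g ∣
∣tabulate∣-mono {f = f} {g} f⇒g =
  p⊆q⇒∣p∣≤∣q∣ (λ {x} x∈f → ∈-tabulate⁺ g (f⇒g x (∈-tabulate⁻ f x∈f)))

∣tabulate∣-removeOne : ∀ {n} (f g : Fin n → Bool) w → f w ≡ true → g w ≡ false →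
  (∀ i → i ≢ w → f i ≡ g i) → ∣ tabulate f ∣ ≡ suc ∣ tabulate g ∣
∣tabulate∣-removeOne f g zero fw gw agree with f zero | g zero | fw | gw
... | true | false | refl | refl =
  cong suc (cong ∣_∣ (tabulate-cong (λ i → agree (suc i) (λ ()))))
∣tabulate∣-removeOne f g (suc w) fw gw agree
  with f zero | g zero | agree zero (λ ())
     | ∣tabulate∣-removeOne (f ∘ suc) (g ∘ suc) w fw gw
         (λ i i≢w → agree (suc i) (i≢w ∘ Fin.suc-injective))
... | true  | true  | refl | tail = cong suc tail
... | false | false | refl | tail = tail

∣p∣>0⇒nonempty : ∀ {n} {p : Subset n} → 0 < ∣ p ∣ → Nonempty p
∣p∣>0⇒nonempty {n} {p} 0<∣p∣ with nonempty? p
... | yes p≠∅ = p≠∅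
... | no  p=∅ = contradiction (sym (trans (cong ∣_∣ (Empty-unique p=∅)) (∣⊥∣≡0 n))) (<⇒≢ 0<∣p∣)

x∈p─q⇒x∉q : ∀ {n} {p q : Subset n} {x} → x ∈ p ─ q → x ∉ q
x∈p─q⇒x∉q {p = inside  ∷ _} {outside ∷ _} {zero} here ()
x∈p─q⇒x∉q {p = inside  ∷ _} {inside  ∷ _} {zero} ()
x∈p─q⇒x∉q {p = outside ∷ _} {inside  ∷ _} {zero} ()
x∈p─q⇒x∉q {p = outside ∷ _} {outside ∷ _} {zero} ()
x∈p─q⇒x∉q {p = _ ∷ _} {_ ∷ _} {suc _} (there x∈p─q) (there x∈q) = x∈p─q⇒x∉q x∈p─q x∈q

0<ᵇ-mono : ∀ {a b} → a ≤ b → (0 <ᵇ a) ≡ true → (0 <ᵇ b) ≡ true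
0<ᵇ-mono {zero}  _       ()
0<ᵇ-mono {suc _} (s≤s _) _ = refl

data ArcCase {n} (x w a b : Fin n) : Set where
  arc     : a ≡ x → b ≡ w → ArcCase x w a b
  reverse : a ≡ w → b ≡ x → ArcCase x w a b
  other   : ¬ (a ≡ x × b ≡ w) → ¬ (a ≡ w × b ≡ x) → ArcCase x w a b

arcCase : ∀ {n} (x w a b : Fin n) → ArcCase x w a b
arcCase x w a b with a ≟ x ×-dec b ≟ w | a ≟ w ×-dec b ≟ x
... | yes (a≡x , b≡w) | _                 = arc a≡x b≡w
... | no ¬arc         | yes (a≡w , b≡x)   = reverse a≡w b≡x
... | no ¬arc         | no ¬rev           = other ¬arc ¬rev

reverseArc : ∀ {n} → Arcs n → Fin n → Fin n → Arcs n
reverseArc O x w a b with arcCase x w a b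
... | arc _ _     = false
... | reverse _ _ = true
... | other _ _   = O a b

module _ {n} (O : Arcs n) {x w : Fin n} where

  reverseArc-arc : x ≢ w → reverseArc O x w x w ≡ false
  reverseArc-arc x≢w with arcCase x w x w
  ... | arc _ _       = refl
  ... | reverse x≡w _ = contradiction x≡w x≢w
  ... | other ¬arc _  = contradiction (refl , refl) ¬arc

  reverseArc-reverse : x ≢ w → reverseArc O x w w x ≡ true
  reverseArc-reverse x≢w with arcCase x w w x
  ... | arc w≡x _     = contradiction (sym w≡x) x≢w
  ... | reverse _ _   = refl
  ... | other _ ¬rev  = contradiction (refl , refl) ¬rev

  reverseArc-other : ∀ {a b} → ¬ (a ≡ x × b ≡ w) → ¬ (a ≡ w × b ≡ x) →
    reverseArc O x w a b ≡ O a b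
  reverseArc-other {a} {b} ¬arc ¬rev with arcCase x w a b
  ... | arc a≡x b≡w     = contradiction (a≡x , b≡w) ¬arc
  ... | reverse a≡w b≡x = contradiction (a≡w , b≡x) ¬rev
  ... | other _ _       = refl

  reverseArc-inArc : ∀ {i y} → y ≢ x → reverseArc O x w i y ≡ true → O i y ≡ true
  reverseArc-inArc {i} {y} y≢x e with arcCase x w i y
  reverseArc-inArc y≢x () | arc _ _
  reverseArc-inArc y≢x e  | reverse _ y≡x = contradiction y≡x y≢x
  reverseArc-inArc y≢x e  | other _ _     = e

  outdeg-reverseArc : O x w ≡ true → x ≢ w →
    outdeg O x ≡ suc (outdeg (reverseArc O x w) x)
  outdeg-reverseArc Oxw x≢w =
    ∣tabulate∣-removeOne (O x) (reverseArc O x w x) w Oxw (reverseArc-arc x≢w)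
      (λ i i≢w → sym (reverseArc-other (i≢w ∘ proj₂) (x≢w ∘ proj₁)))

  outdeg-reverseArc-other : ∀ {v} → v ≢ x → v ≢ w →
    outdeg (reverseArc O x w) v ≡ outdeg O v
  outdeg-reverseArc-other {v} v≢x v≢w =
    cong ∣_∣ (tabulate-cong (λ i → reverseArc-other {v} {i} (v≢x ∘ proj₁) (v≢w ∘ proj₁)))

module _ {n} (G : Graph n) (α : Tree n) where

  EdgeAt-sym : ∀ {u v} → EdgeAt G α u v → EdgeAt G α v u
  EdgeAt-sym {u} {v} (uv , u∈V , v∈V , ¬bothInBag) =
    trans (Graph.sym G v u) uv , v∈V , u∈V , ¬bothInBag ∘ swap

  EdgeAt⇒≢ : ∀ {u v} → EdgeAt G α u v → u ≢ v
  EdgeAt⇒≢ {u} (uu , _) refl with trans (sym uu) (irrefl G u)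
  ... | ()

  EdgeAt-leavesBag : ∀ {u v} → EdgeAt G α u v → u ∈ bag α → v ∉ bag α
  EdgeAt-leavesBag (_ , _ , _ , ¬bothInBag) u∈B v∈B = ¬bothInBag (u∈B , v∈B)

  reverseArc-isOrientation : ∀ {O x w} → IsOrientation G α O → O x w ≡ true →
    IsOrientation G α (reverseArc O x w)
  reverseArc-isOrientation {O} {x} {w} isO Oxw =
    record { onEdges = onEdges′ ; total = total′ ; antisym = antisym′ }
    where
    open IsOrientation isO
    xw : EdgeAt G α x w
    xw = onEdges x w Oxw
    x≢w : x ≢ w
    x≢w = EdgeAt⇒≢ xw

    onEdges′ : ∀ a b → reverseArc O x w a b ≡ true → EdgeAt G α a b
    onEdges′ a b e with arcCase x w a b
    onEdges′ a b () | arc _ _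
    onEdges′ a b e  | reverse refl refl = EdgeAt-sym xw
    onEdges′ a b e  | other _ _         = onEdges a b e

    total′ : ∀ a b → EdgeAt G α a b →
      reverseArc O x w a b ≡ true ⊎ reverseArc O x w b a ≡ true
    total′ a b ab with arcCase x w a b
    ... | arc refl refl     = inj₂ (reverseArc-reverse O x≢w)
    ... | reverse refl refl = inj₁ refl
    ... | other ¬arc ¬rev with total a b ab
    ...   | inj₁ Oab = inj₁ Oab
    ...   | inj₂ Oba = inj₂ (trans (reverseArc-other O (¬rev ∘ swap) (¬arc ∘ swap)) Oba)

    antisym′ : ∀ a b → reverseArc O x w a b ≡ true → reverseArc O x w b a ≡ true → ⊥
    antisym′ a b e e′ with arcCase x w a b
    antisym′ a b () e′ | arc _ _
    antisym′ a b e e′  | reverse refl refl with trans (sym e′) (reverseArc-arc O x≢w)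
    ... | ()
    antisym′ a b e e′  | other ¬arc ¬rev =
      antisym a b e (trans (sym (reverseArc-other O (¬rev ∘ swap) (¬arc ∘ swap))) e′)

  record Lowering (O O′ : Arcs n) : Set where
    field
      isOrientation : IsOrientation G α O′
      inArcs⊆       : ∀ {i y} → y ∉ bag α → O′ i y ≡ true → O i y ≡ true

  Lowering-refl : ∀ {O} → IsOrientation G α O → Lowering O O
  Lowering-refl isO = record { isOrientation = isO ; inArcs⊆ = λ _ Oiy → Oiy }

  Lowering-trans : ∀ {O₁ O₂ O₃} → Lowering O₁ O₂ → Lowering O₂ O₃ → Lowering O₁ O₃
  Lowering-trans l₁₂ l₂₃ = record
    { isOrientation = Lowering.isOrientation l₂₃
    ; inArcs⊆       = λ y∉B → Lowering.inArcs⊆ l₁₂ y∉B ∘ Lowering.inArcs⊆ l₂₃ y∉B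
    }

  Lowering-indeg : ∀ {O O′ y} → Lowering O O′ → y ∉ bag α → indeg O′ y ≤ indeg O y
  Lowering-indeg l y∉B = ∣tabulate∣-mono (λ i → Lowering.inArcs⊆ l {i} y∉B)

  Lowering-positiveIn : ∀ {O O′} → Lowering O O′ →
    ∣ Yset α ∩ positiveIn O′ ∣ ≤ ∣ Yset α ∩ positiveIn O ∣
  Lowering-positiveIn l = p⊆q⇒∣p∣≤∣q∣ λ y∈ →
    let y∈Y , y∈P′ = x∈p∩q⁻ (Yset α) _ y∈
    in  x∈p∩q⁺ (y∈Y , ∈-tabulate⁺ _
          (0<ᵇ-mono (Lowering-indeg l (x∈p─q⇒x∉q y∈Y)) (∈-tabulate⁻ _ y∈P′)))

  OutdegsInBagKeptExcept : Fin n → Arcs n → Arcs n → Set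
  OutdegsInBagKeptExcept x O O′ = ∀ {v} → v ∈ bag α → v ≢ x → outdeg O′ v ≡ outdeg O v

  lowerOutdeg-byOne : ∀ {O x m} → IsOrientation G α O → x ∈ bag α → outdeg O x ≡ suc m →
    ∃ λ O′ → Lowering O O′ × outdeg O′ x ≡ m × OutdegsInBagKeptExcept x O O′
  lowerOutdeg-byOne {O} {x} {m} isO x∈B outdeg≡ =
    reverseArc O x w , lowering , outdeg-x , outdeg-others
    where
    open IsOrientation isO
    out-neighbour : Nonempty (tabulate (O x))
    out-neighbour = ∣p∣>0⇒nonempty (subst (0 <_) (sym outdeg≡) (s≤s z≤n))
    w : Fin n
    w = proj₁ out-neighbour
    Oxw : O x w ≡ true
    Oxw = ∈-tabulate⁻ (O x) (proj₂ out-neighbour)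
    x≢w : x ≢ w
    x≢w = EdgeAt⇒≢ (onEdges x w Oxw)
    w∉B : w ∉ bag α
    w∉B = EdgeAt-leavesBag (onEdges x w Oxw) x∈B

    lowering : Lowering O (reverseArc O x w)
    lowering = record
      { isOrientation = reverseArc-isOrientation isO Oxw
      ; inArcs⊆       = λ y∉B → reverseArc-inArc O (λ { refl → y∉B x∈B })
      }
    outdeg-x : outdeg (reverseArc O x w) x ≡ m
    outdeg-x = suc-injective (trans (sym (outdeg-reverseArc O Oxw x≢w)) outdeg≡)
    outdeg-others : OutdegsInBagKeptExcept x O (reverseArc O x w)
    outdeg-others v∈B v≢x = outdeg-reverseArc-other O v≢x (λ { refl → w∉B v∈B })

  lowerOutdeg : ∀ {O x m} → IsOrientation G α O → x ∈ bag α → m ≤ outdeg O x →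
    ∃ λ O′ → Lowering O O′ × outdeg O′ x ≡ m × OutdegsInBagKeptExcept x O O′
  lowerOutdeg {x = x} {m} isO x∈B m≤ = go isO (≤⇒≤′ m≤) refl
    where
    go : ∀ {O k} → IsOrientation G α O → m ≤′ k → outdeg O x ≡ k →
      ∃ λ O′ → Lowering O O′ × outdeg O′ x ≡ m × OutdegsInBagKeptExcept x O O′
    go isO ≤′-refl outdeg≡ = _ , Lowering-refl isO , outdeg≡ , λ _ _ → refl
    go isO (≤′-step m≤′k) outdeg≡ =
      let O₁ , l₁ , outdeg₁≡ , kept₁ = lowerOutdeg-byOne isO x∈B outdeg≡
          O₂ , l₂ , outdeg₂≡ , kept₂ = go (Lowering.isOrientation l₁) m≤′k outdeg₁≡
      in  O₂ , Lowering-trans l₁ l₂ , outdeg₂≡ ,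
          λ v∈B v≢x → trans (kept₂ v∈B v≢x) (kept₁ v∈B v≢x)

  lowerOutdegs : ∀ {O} (d : Fin n → ℕ) (vs : List (Fin n)) → IsOrientation G α O →
    (∀ {v} → v ∈ bag α → d v ≤ outdeg O v) →
    ∃ λ O′ → Lowering O O′ × (∀ {v} → v ∈ bag α → d v ≤ outdeg O′ v)
                           × (∀ {v} → v ∈ bag α → v List.∈ vs → outdeg O′ v ≡ d v)
  lowerOutdegs d [] isO d≤ = _ , Lowering-refl isO , d≤ , λ _ ()
  lowerOutdegs d (x ∷ vs) isO d≤
    with lowerOutdegs d vs isO d≤ | x ∈? bag α
  ... | O₁ , l₁ , d≤₁ , ≡d₁ | no x∉B = O₁ , l₁ , d≤₁ , ≡d
    where
    ≡d : ∀ {v} → v ∈ bag α → v List.∈ x ∷ vs → outdeg O₁ v ≡ d v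
    ≡d v∈B (Any.here refl)  = contradiction v∈B x∉B
    ≡d v∈B (Any.there v∈vs) = ≡d₁ v∈B v∈vs
  ... | O₁ , l₁ , d≤₁ , ≡d₁ | yes x∈B
    with lowerOutdeg (Lowering.isOrientation l₁) x∈B (d≤₁ x∈B)
  ...   | O₂ , l₂ , outdeg-x , kept = O₂ , Lowering-trans l₁ l₂ , d≤₂ , ≡d₂
    where
    d≤₂ : ∀ {v} → v ∈ bag α → d v ≤ outdeg O₂ v
    d≤₂ {v} v∈B with v ≟ x
    ... | yes refl = ≤-reflexive (sym outdeg-x)
    ... | no v≢x   = subst (d v ≤_) (sym (kept v∈B v≢x)) (d≤₁ v∈B)
    ≡d₂ : ∀ {v} → v ∈ bag α → v List.∈ x ∷ vs → outdeg O₂ v ≡ d v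
    ≡d₂ {v} v∈B v∈x∷vs with v ≟ x | v∈x∷vs
    ... | yes refl | _              = outdeg-x
    ... | no v≢x   | Any.here v≡x   = contradiction v≡x v≢x
    ... | no v≢x   | Any.there v∈vs = trans (kept v∈B v≢x) (≡d₁ v∈B v∈vs)

lemma7 : ∀ {n} (G : Graph n) (c : Fin n → ℕ) (T : Tree n) →
    IsTreeDecomposition G T → IsNice T →
    ∀ α → α ⊑ T →
    ∀ d k → InR G c α d k →
    ∀ d' k' → (∀ v → v ∈ bag α → d' v ≤ d v) →
    k ≤ k' → k' ≤ ∣ Yset α ∣ →
    InR G c α d' k'
lemma7 {n} G _ _ _ _ α _ _ _ (_ , isO , d≡outdeg , indeg≤c , ∣pos∣≤k , _)
       d' k' d'≤d k≤k' k'≤∣Y∣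
  with lowerOutdegs G α d' (allFin n) isO
         (λ {v} v∈B → subst (d' v ≤_) (d≡outdeg v v∈B) (d'≤d v v∈B))
... | O′ , lowering , _ , outdeg≡d' =
  O′ , isOrientation ,
  (λ v v∈B → sym (outdeg≡d' v∈B (∈-allFin v))) ,
  (λ v v∈Y → ≤-trans (Lowering-indeg G α lowering (x∈p─q⇒x∉q v∈Y)) (indeg≤c v v∈Y)) ,
  ≤-trans (Lowering-positiveIn G α lowering) (≤-trans ∣pos∣≤k k≤k') ,
  k'≤∣Y∣
  where open Lowering lowering
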